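{- Let $d\ge1$ and let $\mathcal{F}\subseteq \binom{\mathbb{N}}{d}$ be a finite family of $d$-sets. Then \begin{align*} \mathcal{C}^{(l)}(\mathrm{Inc}(\mathcal{F}))&=\bigcup_{k\geq 1}\{(k,\widehat{\mathbf{u}})\mid \widehat{\mathbf{u}}\in \mathcal{C}_{>k}\big(\mathrm{Inc}(\widehat{\mathcal{F}}_{1,k})\cup \pi_1(\widehat{\mathcal{F}}_{1,k-1})\big)\},\\ \mathcal{C}^{(r)}(\mathrm{Inc}(\mathcal{F}))&=\bigcup_{k\geq 1}\{(\widehat{\mathbf{u}},k)\mid \widehat{\mathbf{u}}\in \mathcal{C}\big(\widehat{\mathcal{F}}_{d,k}\cup\mathrm{Inc}(\widehat{\mathcal{F}}_{d,k-1})\big)\},\\ \mathrm{Inc}(\mathcal{C}^{(l)}(\mathcal{F}))&=\bigcup_{k\geq 1}\{(k,\widehat{\mathbf{u}})\mid \widehat{\mathbf{u}}\in \mathrm{Inc}\big(\mathcal{C}_{>k}(\widehat{\mathcal{F}}_{1,k})\big)\cup \pi_1\big(\mathcal{C}_{>k-1}(\widehat{\mathcal{F}}_{1,k-1})\big)\},\\ \mathrm{Inc}(\mathcal{C}^{(r)}(\mathcal{F}))&=\bigcup_{k\geq 1}\{(\widehat{\mathbf{u}},k)\mid \widehat{\mathbf{u}}\in \mathcal{C}(\widehat{\mathcal{F}}_{d,k})\cup\mathrm{Inc}\big(\mathcal{C}(\widehat{\mathcal{F}}_{d,k-1})\big)\}. \end{align*}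
   Context: $\mathbb{N}=\{1,2,\dots\}$, $\mathbb{N}_{>k}=\{n\in\mathbb{N}:n>k\}$ (so $\mathbb{N}_{>0}=\mathbb{N}$); $e$-subsets are written $\mathbf{u}=(u_1,\dots,u_e)$ with $u_1<\dots<u_e$; $(k,\widehat{\mathbf{u}})$ denotes $\{k\}\cup\widehat{\mathbf{u}}$ with $k<\min\widehat{\mathbf{u}}$ and $(\widehat{\mathbf{u}},k)$ denotes $\widehat{\mathbf{u}}\cup\{k\}$ with $\max\widehat{\mathbf{u}}<k$. Squashed order: $\mathbf{u}<\mathbf{v}$ if the largest element of the symmetric difference lies in $\mathbf{v}$. For finite $\mathcal{A}\subseteq\binom{\mathbb{N}}{e}$, $\mathcal{C}(\mathcal{A})$ is the set of the $|\mathcal{A}|$ smallest elements of $\binom{\mathbb{N}}{e}$; for $\mathcal{A}\subseteq\binom{\mathbb{N}_{>k}}{e}$, $\mathcal{C}_{>k}(\mathcal{A})$ is the set of the $|\mathcal{A}|$ smallest elements of $\binom{\mathbb{N}_{>k}}{e}$ (with $\mathcal{C}_{>0}=\mathcal{C}$). $\mathrm{Inc}_1$ is the set of maps $\pi:\mathbb{N}\to\mathbb{N}$ with $\pi(j)<\pi(j+1)$, $\pi(j)\le j+1$ for all $j$, acting by $\pi(\mathbf{u})=(\pi(u_1),\dots,\pi(u_e))$; $\mathrm{Inc}(\mathcal{A})=\{\pi(\mathbf{u})\mid\mathbf{u}\in\mathcal{A},\pi\in\mathrm{Inc}_1\}$; $\pi_1(j)=j+1$ and $\pi_1(\mathcal{A})=\{\pi_1(\mathbf{u})\mid\mathbf{u}\in\mathcal{A}\}$.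 For $k\ge1$: $\widehat{\mathcal{F}}_{1,k}=\{\widehat{\mathbf{u}}\in\binom{\mathbb{N}}{d-1}\mid (k,\widehat{\mathbf{u}})\in\mathcal{F}\}$, $\widehat{\mathcal{F}}_{d,k}=\{\widehat{\mathbf{u}}\in\binom{\mathbb{N}}{d-1}\mid (\widehat{\mathbf{u}},k)\in\mathcal{F}\}$, and $\widehat{\mathcal{F}}_{1,0}=\widehat{\mathcal{F}}_{d,0}=\emptyset$. Left partial compression: $\mathcal{C}^{(l)}(\mathcal{F})=\bigcup_{k\ge1}\{(k,\widehat{\mathbf{u}})\mid\widehat{\mathbf{u}}\in\mathcal{C}_{>k}(\widehat{\mathcal{F}}_{1,k})\}$; right partial compression: $\mathcal{C}^{(r)}(\mathcal{F})=\bigcup_{k\ge1}\{(\widehat{\mathbf{u}},k)\mid\widehat{\mathbf{u}}\in\mathcal{C}(\widehat{\mathcal{F}}_{d,k})\}$. -}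

module Defs where

open import Data.Nat using (ℕ; zero; suc; _<_; _≤_; _∸_)
open import Data.List using (List; []; _∷_; _++_; [_]; length; map)
open import Data.List.Membership.Propositional using (_∈_; _∉_)
open import Data.List.Relation.Unary.All using (All)
open import Data.List.Relation.Unary.Linked using (Linked)
open import Data.List.Relation.Unary.Unique.Propositional using (Unique)
open import Data.Product using (Σ; ∃; ∃-syntax; _×_)
open import Data.Sum using (_⊎_)
open import Function.Bundles using (_⇔_)
open import Relation.Binary.PropositionalEquality using (_≡_)

-- A finite subset of ℕ is represented by the strictly increasing list of its
-- elements.  ESet e k u : u is an e-subset of ℕ_{>k}  (ℕ = ℕ_{>0} = {1,2,...}).
ESet : ℕ → ℕ → List ℕ → Set
ESet e k u = length u ≡ e × Linked _<_ u × All (k <_) u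

Family : Set₁
Family = List ℕ → Set

_≐_ : Family → Family → Set
A ≐ B = ∀ u → A u ⇔ B u

_∪_ : Family → Family → Family
(A ∪ B) u = A u ⊎ B u

fam : List (List ℕ) → Family
fam F u = u ∈ F

HasSize : Family → ℕ → Set
HasSize A n = Σ (List (List ℕ)) λ xs →
  Unique xs × length xs ≡ n × (∀ u → (u ∈ xs) ⇔ A u)

-- Squashed order: u < v iff the largest element of the symmetric difference lies in v.
SqLt : List ℕ → List ℕ → Set
SqLt u v = Σ ℕ λ m → m ∈ v × m ∉ u × (∀ x → m < x → (x ∈ u ⇔ x ∈ v))

Below : ℕ → ℕ → List ℕ → Family
Below e k u v = ESet e k v × SqLt v u

-- Compression C_{>k}(A) for A a family of e-sets: the |A| smallest elements of
-- binom(ℕ_{>k}, e) in squashed order, i.e. those e-subsets u of ℕ_{>k} having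
-- fewer than |A| predecessors.  C = Comp e 0.
Comp : ℕ → ℕ → Family → Family
Comp e k A u = ESet e k u × ∃[ n ] ∃[ m ] (HasSize A n × HasSize (Below e k u) m × m < n)

-- Inc_1 : strictly increasing π : ℕ → ℕ (on ℕ = {1,2,...}) with π(j) ≤ j+1.
-- (The value at 0 is irrelevant.)
IsInc1 : (ℕ → ℕ) → Set
IsInc1 π = ∀ j → 1 ≤ j → (1 ≤ π j) × (π j < π (suc j)) × (π j ≤ suc j)

Inc : Family → Family
Inc A w = ∃[ u ] ∃[ π ] (A u × IsInc1 π × w ≡ map π u)

π₁ : Family → Family
π₁ A w = ∃[ u ] (A u × w ≡ map suc u)

hat1 : ℕ → Family → ℕ → Family
hat1 d G k û = 1 ≤ k × ESet (d ∸ 1) 0 û × G (k ∷ û)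

hatd : ℕ → Family → ℕ → Family
hatd d G k û = 1 ≤ k × ESet (d ∸ 1) 0 û × G (û ++ [ k ])

LUnion : (ℕ → Family) → Family
LUnion H w = ∃[ k ] ∃[ û ] (1 ≤ k × H k û × w ≡ k ∷ û)

RUnion : (ℕ → Family) → Family
RUnion H w = ∃[ k ] ∃[ û ] (1 ≤ k × H k û × w ≡ û ++ [ k ])

CompL : ℕ → Family → Family
CompL d G = LUnion (λ k → Comp (d ∸ 1) k (hat1 d G k))

CompR : ℕ → Family → Family
CompR d G = RUnion (λ k → Comp (d ∸ 1) 0 (hatd d G k))

module Submission where

-- A family G of d-sets is the disjoint union of its slices: G = ⋃_k (k, Ĝ_{1,k})
-- (sorting by the minimum) and G = ⋃_k (Ĝ_{d,k}, k) (sorting by the maximum).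
-- The whole lemma rests on two "slice formulas" for Inc, valid for any
-- sliced family H:
--   Inc(⋃_k (k, H_k)) = ⋃_k (k, Inc(H_k) ∪ π₁(H_{k-1}))   if H_k ⊆ binom(ℕ_{>k}),
--   Inc(⋃_k (H_k, k)) = ⋃_k (H_k ∪ Inc(H_{k-1}), k)       if H_k ⊆ binom([k-1]).
-- They hold because a map π ∈ Inc₁ fixes an initial segment of ℕ and shifts
-- everything after it by one; so π either fixes the distinguished element k
-- (and then acts on the other elements as an Inc₁ map, resp. as the identity)
-- or moves it to k+1 (and then acts on the larger elements as π₁, resp. as an
-- Inc₁ map).  The first two identities follow by slicing Inc(F) with these
-- formulas, since a partial compression just compresses every slice.  The last
-- two apply the formulas to the sliced family C^(l)(F), resp. C^(r)(F); the
-- right-hand case additionally needs that compressing a family of subsets of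
-- [k-1] yields subsets of [k-1] (Comp-bounded).

open import Defs
open import Data.Nat using (ℕ; zero; suc; _+_; _≤_; _<_; _∸_; z≤n; s≤s; z<s; _≤?_; _<?_; _≤′_; ≤′-refl; ≤′-step)
open import Data.Nat.Properties
open import Data.List using (List; []; _∷_; _++_; [_]; length; map)
open import Data.List.Properties using (map-++; map-id; length-map; length-++; ∷-injective; ∷ʳ-injective)
open import Data.List.Reverse as Reverse using (Reverse; reverseView; _∶_∶ʳ_)
open import Data.List.Membership.Propositional using (_∈_)
open import Data.List.Membership.Propositional.Properties using (∈-∃++; ∈-++⁻; ∈-++⁺ˡ; ∈-++⁺ʳ)
open import Data.List.Relation.Unary.Any using (here; there)
open import Data.List.Relation.Unary.All as All using (All; []; _∷_)
open import Data.List.Relation.Unary.All.Properties using (++⁻ˡ; ++⁻ʳ)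
open import Data.List.Relation.Unary.AllPairs as AllPairs using (_∷_)
open import Data.List.Relation.Unary.Linked as Linked using (Linked; []; [-]; _∷_)
open import Data.List.Relation.Unary.Linked.Properties using (Linked⇒AllPairs)
open import Data.List.Relation.Unary.Unique.Propositional using (Unique)
open import Data.Product using (_×_; _,_; proj₁; proj₂)
open import Data.Sum using (_⊎_; inj₁; inj₂)
open import Data.Empty using (⊥-elim)
open import Relation.Nullary using (¬_; yes; no)
open import Function.Bundles using (mk⇔; Equivalence)
open import Function.Properties.Equivalence as ⇔ using ()
open import Relation.Binary.PropositionalEquality using (_≡_; refl; sym; trans; cong; cong₂; subst)

open Equivalence using (to; from)

≐-trans : ∀ {A B C} → A ≐ B → B ≐ C → A ≐ C
≐-trans p q u = ⇔.trans (p u) (q u)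

≐-sym : ∀ {A B} → A ≐ B → B ≐ A
≐-sym p u = ⇔.sym (p u)

HasSize-cong : ∀ {A B n} → A ≐ B → HasSize A n → HasSize B n
HasSize-cong A≐B (xs , uq , len , enum) = xs , uq , len , λ u → ⇔.trans (enum u) (A≐B u)

-- A compression only depends on the size of the compressed family.
Comp-cong : ∀ {A B} e k → A ≐ B → Comp e k A ≐ Comp e k B
Comp-cong e k A≐B u = mk⇔
  (λ { (es , n , m , sizeA , sizeBelow , m<n) → es , n , m , HasSize-cong A≐B sizeA , sizeBelow , m<n })
  (λ { (es , n , m , sizeB , sizeBelow , m<n) → es , n , m , HasSize-cong (≐-sym A≐B) sizeB , sizeBelow , m<n })

Inc-cong : ∀ {A B} → A ≐ B → Inc A ≐ Inc B
Inc-cong A≐B w = mk⇔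
  (λ { (u , π , a , inc , eq) → u , π , to (A≐B u) a , inc , eq })
  (λ { (u , π , b , inc , eq) → u , π , from (A≐B u) b , inc , eq })

hat1-cong : ∀ d {G G′} → G ≐ G′ → ∀ k → hat1 d G k ≐ hat1 d G′ k
hat1-cong d G≐G′ k û = mk⇔
  (λ { (1≤k , es , g) → 1≤k , es , to (G≐G′ _) g })
  (λ { (1≤k , es , g) → 1≤k , es , from (G≐G′ _) g })

hatd-cong : ∀ d {G G′} → G ≐ G′ → ∀ k → hatd d G k ≐ hatd d G′ k
hatd-cong d G≐G′ k û = mk⇔
  (λ { (1≤k , es , g) → 1≤k , es , to (G≐G′ _) g })
  (λ { (1≤k , es , g) → 1≤k , es , from (G≐G′ _) g })

LUnion-cong : ∀ {H H′} → (∀ k → 1 ≤ k → H k ≐ H′ k) → LUnion H ≐ LUnion H′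
LUnion-cong H≐H′ w = mk⇔
  (λ { (k , û , 1≤k , h , eq) → k , û , 1≤k , to (H≐H′ k 1≤k û) h , eq })
  (λ { (k , û , 1≤k , h , eq) → k , û , 1≤k , from (H≐H′ k 1≤k û) h , eq })

RUnion-cong : ∀ {H H′} → (∀ k → 1 ≤ k → H k ≐ H′ k) → RUnion H ≐ RUnion H′
RUnion-cong H≐H′ w = mk⇔
  (λ { (k , û , 1≤k , h , eq) → k , û , 1≤k , to (H≐H′ k 1≤k û) h , eq })
  (λ { (k , û , 1≤k , h , eq) → k , û , 1≤k , from (H≐H′ k 1≤k û) h , eq })

Linked-head : ∀ {k v} → Linked _<_ (k ∷ v) → All (k <_) v
Linked-head sorted = AllPairs.head (Linked⇒AllPairs <-trans sorted)

Linked-init : ∀ v {k} → Linked _<_ (v ++ [ k ]) → Linked _<_ v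
Linked-init []          sorted         = []
Linked-init (x ∷ [])    sorted         = [-]
Linked-init (x ∷ y ∷ v) (x<y ∷ sorted) = x<y ∷ Linked-init (y ∷ v) sorted

Linked-last : ∀ v {k} → Linked _<_ (v ++ [ k ]) → All (_< k) v
Linked-last []      sorted = []
Linked-last (x ∷ v) sorted with ++⁻ʳ v (Linked-head sorted)
... | x<k ∷ [] = x<k ∷ Linked-last v (Linked.tail sorted)

map-local : ∀ {P : ℕ → Set} {f g : ℕ → ℕ} {v} → All P v → (∀ x → P x → f x ≡ g x) → map f v ≡ map g v
map-local []       agree = refl
map-local (p ∷ ps) agree = cong₂ _∷_ (agree _ p) (map-local ps agree)

-- Maps in Inc₁.  Such a π satisfies j ≤ π j ≤ j+1, and once π j = j+1 it stays
-- a shift: π fixes an initial segment and is suc beyond it.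

module Inc₁Map {π : ℕ → ℕ} (inc : IsInc1 π) where

  π-strict : ∀ j → 1 ≤ j → π j < π (suc j)
  π-strict j 1≤j = proj₁ (proj₂ (inc j 1≤j))

  π-bound : ∀ j → 1 ≤ j → π j ≤ suc j
  π-bound j 1≤j = proj₂ (proj₂ (inc j 1≤j))

  π-ge : ∀ j → 1 ≤ j → j ≤ π j
  π-ge (suc zero)    _ = proj₁ (inc 1 (s≤s z≤n))
  π-ge (suc (suc j)) _ = ≤-trans (s≤s (π-ge (suc j) (s≤s z≤n))) (π-strict (suc j) (s≤s z≤n))

  π-mono : ∀ {x y} → 1 ≤ x → x < y → π x < π y
  π-mono {x} {suc y} 1≤x (s≤s x≤y) with m≤n⇒m<n∨m≡n x≤y
  ... | inj₂ refl = π-strict x 1≤x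
  ... | inj₁ x<y  = <-trans (π-mono 1≤x x<y) (π-strict y (≤-trans 1≤x x≤y))

  π-case : ∀ j → 1 ≤ j → π j ≡ j ⊎ π j ≡ suc j
  π-case j 1≤j with m≤n⇒m<n∨m≡n (π-ge j 1≤j)
  ... | inj₂ eq  = inj₁ (sym eq)
  ... | inj₁ j<π = inj₂ (≤-antisym (π-bound j 1≤j) j<π)

  π-shift : ∀ {i j} → π j ≡ suc j → 1 ≤ j → j ≤ i → π i ≡ suc i
  π-shift {i} {j} πj 1≤j j≤i = go (≤⇒≤′ j≤i)
    where
    go : ∀ {i} → j ≤′ i → π i ≡ suc i
    go ≤′-refl = πj
    go {suc i} (≤′-step j≤′i) = ≤-antisym (π-bound (suc i) z<s)
      (subst (_< π (suc i)) (go j≤′i) (π-strict i (≤-trans 1≤j (≤′⇒≤ j≤′i))))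

  π-fixBelow : ∀ {i j} → π j ≡ j → 1 ≤ i → i ≤ j → π i ≡ i
  π-fixBelow {i} {j} πj 1≤i i≤j with π-case i 1≤i
  ... | inj₁ πi = πi
  ... | inj₂ πi = ⊥-elim (1+n≢n (trans (sym (π-shift πi 1≤i i≤j)) πj))

open Inc₁Map

id-inc : IsInc1 (λ x → x)
id-inc j 1≤j = 1≤j , ≤-refl , n≤1+n j

suc-inc : IsInc1 suc
suc-inc j 1≤j = z<s , ≤-refl , ≤-refl

glueL : ℕ → (ℕ → ℕ) → ℕ → ℕ
glueL k π i with i ≤? k
... | yes _ = i
... | no  _ = π i

glueL-inc : ∀ k {π} → IsInc1 π → IsInc1 (glueL k π)
glueL-inc k {π} inc j 1≤j with j ≤? k | suc j ≤? k
... | yes _   | yes _    = 1≤j , ≤-refl , n≤1+n j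
... | yes j≤k | no  j+1≰k = 1≤j , ≤-<-trans j≤k (≤-trans (≰⇒> j+1≰k) (π-ge inc (suc j) z<s)) , n≤1+n j
... | no  j≰k | yes j+1≤k = ⊥-elim (j≰k (≤-trans (n≤1+n j) j+1≤k))
... | no  _   | no  _    = inc j 1≤j

glueL-at : ∀ k π → glueL k π k ≡ k
glueL-at k π with k ≤? k
... | yes _   = refl
... | no  k≰k = ⊥-elim (k≰k ≤-refl)

glueL-above : ∀ k π i → k < i → glueL k π i ≡ π i
glueL-above k π i k<i with i ≤? k
... | yes i≤k = ⊥-elim (<⇒≱ k<i i≤k)
... | no  _   = refl

glueR : ℕ → (ℕ → ℕ) → ℕ → ℕ
glueR t π i with suc i ≤? t
... | yes _ = π i
... | no  _ = suc i

glueR-inc : ∀ t {π} → IsInc1 π → IsInc1 (glueR t π)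
glueR-inc t {π} inc j 1≤j with suc j ≤? t | suc (suc j) ≤? t
... | yes _   | yes _   = inc j 1≤j
... | yes _   | no  _   = proj₁ (inc j 1≤j) , s≤s (π-bound inc j 1≤j) , π-bound inc j 1≤j
... | no  j≮t | yes j+1<t = ⊥-elim (j≮t (≤-trans (n≤1+n (suc j)) j+1<t))
... | no  _   | no  _   = z<s , ≤-refl , ≤-refl

glueR-below : ∀ t π i → i < t → glueR t π i ≡ π i
glueR-below t π i i<t with suc i ≤? t
... | yes _   = refl
... | no  i≮t = ⊥-elim (i≮t i<t)

glueR-at : ∀ t π → glueR t π t ≡ suc t
glueR-at t π with suc t ≤? t
... | yes t<t = ⊥-elim (<-irrefl refl t<t)
... | no  _   = refl

OfESets : ℕ → Family → Set
OfESets e A = ∀ u → A u → ESet e 0 u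

ESet-map : ∀ {e π u} → IsInc1 π → ESet e 0 u → ESet e 0 (map π u)
ESet-map {π = π} {u} inc (len , sorted , positive) =
  trans (length-map π u) len , image-sorted positive sorted , image-positive positive
  where
  image-sorted : ∀ {v} → All (0 <_) v → Linked _<_ v → Linked _<_ (map π v)
  image-sorted []           []             = []
  image-sorted (_ ∷ [])     [-]            = [-]
  image-sorted (1≤x ∷ ps) (x<y ∷ sorted) = π-mono inc 1≤x x<y ∷ image-sorted ps sorted
  image-positive : ∀ {v} → All (0 <_) v → All (0 <_) (map π v)
  image-positive []         = []
  image-positive (1≤x ∷ ps) = proj₁ (inc _ 1≤x) ∷ image-positive ps

Inc-OfESets : ∀ {e A} → OfESets e A → OfESets e (Inc A)
Inc-OfESets esA w (u , π , a , inc , refl) = ESet-map inc (esA u a)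

π₁-OfESets : ∀ {e A} → OfESets e A → OfESets e (π₁ A)
π₁-OfESets esA w (u , a , refl) = ESet-map suc-inc (esA u a)

∪-OfESets : ∀ {e A B} → OfESets e A → OfESets e B → OfESets e (A ∪ B)
∪-OfESets esA esB u (inj₁ a) = esA u a
∪-OfESets esA esB u (inj₂ b) = esB u b

-- If every member of H k lies in ℕ_{>k} and H 0 = ∅,
--   Inc(⋃_k (k, H_k)) = ⋃_k (k, Inc(H_k) ∪ π₁(H_{k-1})):
-- a map π ∈ Inc₁ either fixes k, or sends k to k+1 and then acts as π₁ on ℕ_{>k}.
Inc-LUnion : (H : ℕ → Family) → (∀ k û → H k û → All (k <_) û) → (∀ û → ¬ H 0 û) →
  Inc (LUnion H) ≐ LUnion (λ k → Inc (H k) ∪ π₁ (H (k ∸ 1)))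
Inc-LUnion H above empty₀ w = mk⇔ forward backward
  where
  forward : Inc (LUnion H) w → LUnion (λ k → Inc (H k) ∪ π₁ (H (k ∸ 1))) w
  forward (_ , π , (k , û , 1≤k , h , refl) , inc , refl) with π-case inc k 1≤k
  ... | inj₁ πk≡k = k , map π û , 1≤k , inj₁ (û , π , h , inc , refl) , cong (_∷ map π û) πk≡k
  ... | inj₂ πk≡k+1 = suc k , map suc û , z<s , inj₂ (û , h , refl) ,
        cong₂ _∷_ πk≡k+1 (map-local (above k û h) (λ x k<x → π-shift inc πk≡k+1 1≤k (<⇒≤ k<x)))
  backward : LUnion (λ k → Inc (H k) ∪ π₁ (H (k ∸ 1))) w → Inc (LUnion H) w
  backward (k , _ , 1≤k , inj₁ (v , π , h , inc , refl) , refl) =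
    (k ∷ v) , glueL k π , (k , v , 1≤k , h , refl) , glueL-inc k inc ,
    cong₂ _∷_ (sym (glueL-at k π)) (sym (map-local (above k v h) (glueL-above k π)))
  backward (suc zero , _ , _ , inj₂ (v , h , refl) , refl) = ⊥-elim (empty₀ v h)
  backward (suc (suc k) , _ , _ , inj₂ (v , h , refl) , refl) =
    (suc k ∷ v) , suc , (suc k , v , z<s , h , refl) , suc-inc , refl

-- If every member of H k is a subset of [k-1] and H 0 = ∅,
--   Inc(⋃_k (H_k, k)) = ⋃_k (H_k ∪ Inc(H_{k-1}), k):
-- a map π ∈ Inc₁ either fixes k, hence every element below k, or sends k to k+1.
Inc-RUnion : (H : ℕ → Family) → (∀ k û → H k û → All (_< k) û) → (∀ k û → H k û → All (0 <_) û) →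
  (∀ û → ¬ H 0 û) → Inc (RUnion H) ≐ RUnion (λ k → H k ∪ Inc (H (k ∸ 1)))
Inc-RUnion H below positive empty₀ w = mk⇔ forward backward
  where
  forward : Inc (RUnion H) w → RUnion (λ k → H k ∪ Inc (H (k ∸ 1))) w
  forward (_ , π , (k , û , 1≤k , h , refl) , inc , refl) with π-case inc k 1≤k
  ... | inj₁ πk≡k = k , û , 1≤k , inj₁ h , trans (map-++ π û [ k ]) (cong₂ _++_ π-fixes-û (cong [_] πk≡k))
    where
    π-fixes-û : map π û ≡ û
    π-fixes-û = trans (map-local (All.zip (below k û h , positive k û h))
                                 (λ x (x<k , 1≤x) → π-fixBelow inc πk≡k 1≤x (<⇒≤ x<k)))
                      (map-id û)
  ... | inj₂ πk≡k+1 = suc k , map π û , z<s , inj₂ (û , π , h , inc , refl) ,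
        trans (map-++ π û [ k ]) (cong (map π û ++_) (cong [_] πk≡k+1))
  backward : RUnion (λ k → H k ∪ Inc (H (k ∸ 1))) w → Inc (RUnion H) w
  backward (k , û , 1≤k , inj₁ h , refl) =
    (û ++ [ k ]) , (λ x → x) , (k , û , 1≤k , h , refl) , id-inc , sym (map-id _)
  backward (suc zero , _ , _ , inj₂ (v , π , h , inc , refl) , refl) = ⊥-elim (empty₀ v h)
  backward (suc (suc k) , _ , _ , inj₂ (v , π , h , inc , refl) , refl) =
    (v ++ [ suc k ]) , glueR (suc k) π , (suc k , v , z<s , h , refl) , glueR-inc (suc k) inc ,
    sym (trans (map-++ (glueR (suc k) π) v [ suc k ])
               (cong₂ _++_ (map-local (below (suc k) v h) (glueR-below (suc k) π))
                           (cong [_] (glueR-at (suc k) π))))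

slices-left : ∀ d {G} → 1 ≤ d → OfESets d G → G ≐ LUnion (hat1 d G)
slices-left d {G} 1≤d esG u = mk⇔ (split u) (λ { (k , û , _ , (_ , _ , g) , refl) → g })
  where
  split : ∀ u → G u → LUnion (hat1 d G) u
  split [] g with esG [] g
  ... | (len , _) with subst (1 ≤_) (sym len) 1≤d
  ... | ()
  split (k ∷ û) g with esG (k ∷ û) g
  ... | (len , sorted , 1≤k ∷ positive) =
    k , û , 1≤k , (1≤k , (cong (_∸ 1) len , Linked.tail sorted , positive) , g) , refl

slices-right : ∀ d {G} → 1 ≤ d → OfESets d G → G ≐ RUnion (hatd d G)
slices-right d {G} 1≤d esG u = mk⇔ (split (reverseView u)) (λ { (k , û , _ , (_ , _ , g) , refl) → g })
  where
  split : ∀ {u} → Reverse u → G u → RUnion (hatd d G) u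
  split Reverse.[] g with esG [] g
  ... | (len , _) with subst (1 ≤_) (sym len) 1≤d
  ... | ()
  split (û ∶ _ ∶ʳ k) g with esG (û ++ [ k ]) g
  ... | (len , sorted , positive) with ++⁻ʳ û positive
  ... | 1≤k ∷ [] = k , û , 1≤k , (1≤k , (length-û , Linked-init û sorted , ++⁻ˡ û positive) , g) , refl
    where
    length-û : length û ≡ d ∸ 1
    length-û = trans (sym (m+n∸n≡m (length û) 1)) (cong (_∸ 1) (trans (sym (length-++ û)) len))

hat1-LUnion : ∀ d {H : ℕ → Family} k → 1 ≤ k → OfESets (d ∸ 1) (H k) → hat1 d (LUnion H) k ≐ H k
hat1-LUnion d {H} k 1≤k esH û = mk⇔ slice (λ h → 1≤k , esH û h , (k , û , 1≤k , h , refl))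
  where
  slice : hat1 d (LUnion H) k û → H k û
  slice (_ , _ , (_ , _ , _ , h , eq)) with ∷-injective eq
  ... | refl , refl = h

hatd-RUnion : ∀ d {H : ℕ → Family} k → 1 ≤ k → OfESets (d ∸ 1) (H k) → hatd d (RUnion H) k ≐ H k
hatd-RUnion d {H} k 1≤k esH û = mk⇔ slice (λ h → 1≤k , esH û h , (k , û , 1≤k , h , refl))
  where
  slice : hatd d (RUnion H) k û → H k û
  slice (_ , _ , (_ , û′ , _ , h , eq)) with ∷ʳ-injective û û′ eq
  ... | refl , refl = h

hat1-OfESets : ∀ d G k → OfESets (d ∸ 1) (hat1 d G k)
hat1-OfESets d G k û (_ , es , _) = es

hatd-OfESets : ∀ d G k → OfESets (d ∸ 1) (hatd d G k)
hatd-OfESets d G k û (_ , es , _) = es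

hat1-zero : ∀ d G û → ¬ hat1 d G 0 û
hat1-zero d G û (() , _)

hatd-zero : ∀ d G û → ¬ hatd d G 0 û
hatd-zero d G û (() , _)

hat1-above : ∀ {d G} → OfESets d G → ∀ k û → hat1 d G k û → All (k <_) û
hat1-above esG k û (_ , _ , g) = Linked-head (proj₁ (proj₂ (esG _ g)))

hatd-below : ∀ {d G} → OfESets d G → ∀ k û → hatd d G k û → All (_< k) û
hatd-below esG k û (_ , _ , g) = Linked-last û (proj₁ (proj₂ (esG _ g)))

-- A partial compression compresses every slice, so on a union of slices it
-- compresses the slice families themselves.
CompL-LUnion : ∀ d {G H} → (∀ k → 1 ≤ k → OfESets (d ∸ 1) (H k)) →
  G ≐ LUnion H → CompL d G ≐ LUnion (λ k → Comp (d ∸ 1) k (H k))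
CompL-LUnion d esH G≐H = LUnion-cong λ k 1≤k →
  Comp-cong (d ∸ 1) k (≐-trans (hat1-cong d G≐H k) (hat1-LUnion d k 1≤k (esH k 1≤k)))

CompR-RUnion : ∀ d {G H} → (∀ k → 1 ≤ k → OfESets (d ∸ 1) (H k)) →
  G ≐ RUnion H → CompR d G ≐ RUnion (λ k → Comp (d ∸ 1) 0 (H k))
CompR-RUnion d esH G≐H = RUnion-cong λ k 1≤k →
  Comp-cong (d ∸ 1) 0 (≐-trans (hatd-cong d G≐H k) (hatd-RUnion d k 1≤k (esH k 1≤k)))

Comp-above : ∀ {e k A} u → Comp e k A u → All (k <_) u
Comp-above u ((_ , _ , above) , _) = above

Comp-empty : ∀ {e k A} → (∀ u → ¬ A u) → ∀ u → ¬ Comp e k A u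
Comp-empty noA u (_ , _ , _ , ([] , _ , refl , _) , _ , ())
Comp-empty noA u (_ , _ , _ , (x ∷ _ , _ , _ , enum) , _ , _) = noA x (to (enum x) (here refl))

Unique-⊆-length : ∀ {xs ys : List (List ℕ)} → Unique xs → (∀ {u} → u ∈ xs → u ∈ ys) → length xs ≤ length ys
Unique-⊆-length {[]}     _           _    = z≤n
Unique-⊆-length {x ∷ xs} {ys} (x∉xs ∷ uq) xs⊆ys with ∈-∃++ (xs⊆ys (here refl))
... | ys₁ , ys₂ , refl = begin
  suc (length xs)              ≤⟨ s≤s (Unique-⊆-length uq xs⊆ys₁ys₂) ⟩
  suc (length (ys₁ ++ ys₂))    ≡⟨ cong suc (length-++ ys₁) ⟩
  suc (length ys₁ + length ys₂) ≡⟨ +-suc (length ys₁) (length ys₂) ⟨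
  length ys₁ + length (x ∷ ys₂) ≡⟨ length-++ ys₁ ⟨
  length (ys₁ ++ x ∷ ys₂)      ∎
  where
  open ≤-Reasoning
  xs⊆ys₁ys₂ : ∀ {u} → u ∈ xs → u ∈ ys₁ ++ ys₂
  xs⊆ys₁ys₂ u∈xs with ∈-++⁻ ys₁ (xs⊆ys (there u∈xs))
  ... | inj₁ u∈ys₁        = ∈-++⁺ˡ u∈ys₁
  ... | inj₂ (here refl)  = ⊥-elim (All.lookup x∉xs u∈xs refl)
  ... | inj₂ (there u∈ys₂) = ∈-++⁺ʳ ys₁ u∈ys₂

HasSize-⊆ : ∀ {A B n m} → HasSize A n → HasSize B m → (∀ u → A u → B u) → n ≤ m
HasSize-⊆ (xs , uq , refl , enumA) (ys , _ , refl , enumB) A⊆B =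
  Unique-⊆-length uq (λ {u} u∈xs → from (enumB u) (A⊆B u (to (enumA u) u∈xs)))

SqLt-max : ∀ {u v m} → All (_< m) u → All (_< m) v → SqLt u (v ++ [ m ])
SqLt-max {u} {v} {m} u<m v<m = m , ∈-++⁺ʳ v (here refl) , (λ m∈u → <-irrefl refl (All.lookup u<m m∈u)) ,
  λ y m<y → mk⇔ (λ y∈u → ⊥-elim (<-asym m<y (All.lookup u<m y∈u)))
                (λ y∈v++m → ⊥-elim (<⇒≱ m<y (≤-max y∈v++m)))
  where
  ≤-max : ∀ {y} → y ∈ v ++ [ m ] → y ≤ m
  ≤-max y∈ with ∈-++⁻ v y∈
  ... | inj₁ y∈v       = <⇒≤ (All.lookup v<m y∈v)
  ... | inj₂ (here refl) = ≤-refl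

-- Compressing a family of subsets of [k-1] yields subsets of [k-1]: a set û
-- reaching k would have every member of A below it, hence at least |A|
-- predecessors.
Comp-bounded : ∀ {e k A} → OfESets e A → (∀ u → A u → All (_< k) u) → ∀ û → Comp e 0 A û → All (_< k) û
Comp-bounded {e} {k} {A} esA A<k û (es , n , m , sizeA , sizeBelow , m<n) = All.tabulate bounded
  where
  bounded : ∀ {x} → x ∈ û → x < k
  bounded {x} x∈û with x <? k
  ... | yes x<k = x<k
  ... | no  x≮k = ⊥-elim (<⇒≱ m<n (HasSize-⊆ sizeA sizeBelow (A-below (reverseView û) es x∈û)))
    where
    A-below : ∀ {û} → Reverse û → ESet e 0 û → x ∈ û → ∀ u → A u → Below e 0 û u
    A-below (v ∶ _ ∶ʳ t) (_ , sorted , _) x∈v++t u a =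
      esA u a , SqLt-max (All.map (λ y<k → <-≤-trans y<k k≤t) (A<k u a)) v<t
      where
      v<t : All (_< t) v
      v<t = Linked-last v sorted
      k≤t : k ≤ t
      k≤t with ∈-++⁻ v x∈v++t
      ... | inj₁ x∈v        = ≤-trans (≮⇒≥ x≮k) (<⇒≤ (All.lookup v<t x∈v))
      ... | inj₂ (here refl) = ≮⇒≥ x≮k

lemma3p11 : (d : ℕ) → 1 ≤ d → (F : List (List ℕ)) → All (ESet d 0) F →
    (CompL d (Inc (fam F)) ≐ LUnion (λ k → Comp (d ∸ 1) k (Inc (hat1 d (fam F) k) ∪ π₁ (hat1 d (fam F) (k ∸ 1)))))
    × (CompR d (Inc (fam F)) ≐ RUnion (λ k → Comp (d ∸ 1) 0 (hatd d (fam F) k ∪ Inc (hatd d (fam F) (k ∸ 1)))))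
    × (Inc (CompL d (fam F)) ≐ LUnion (λ k → Inc (Comp (d ∸ 1) k (hat1 d (fam F) k)) ∪ π₁ (Comp (d ∸ 1) (k ∸ 1) (hat1 d (fam F) (k ∸ 1)))))
    × (Inc (CompR d (fam F)) ≐ RUnion (λ k → Comp (d ∸ 1) 0 (hatd d (fam F) k) ∪ Inc (Comp (d ∸ 1) 0 (hatd d (fam F) (k ∸ 1)))))
lemma3p11 d 1≤d F F-dsets = CompL-Inc , CompR-Inc , Inc-CompL , Inc-CompR
  where
  G : Family
  G = fam F

  esG : OfESets d G
  esG u u∈F = All.lookup F-dsets u∈F

  CompL-Inc : CompL d (Inc G) ≐ LUnion (λ k → Comp (d ∸ 1) k (Inc (hat1 d G k) ∪ π₁ (hat1 d G (k ∸ 1))))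
  CompL-Inc = CompL-LUnion d
    (λ k _ → ∪-OfESets (Inc-OfESets (hat1-OfESets d G k)) (π₁-OfESets (hat1-OfESets d G (k ∸ 1))))
    (≐-trans (Inc-cong (slices-left d 1≤d esG)) (Inc-LUnion (hat1 d G) (hat1-above esG) (hat1-zero d G)))
  CompR-Inc : CompR d (Inc G) ≐ RUnion (λ k → Comp (d ∸ 1) 0 (hatd d G k ∪ Inc (hatd d G (k ∸ 1))))
  CompR-Inc = CompR-RUnion d
    (λ k _ → ∪-OfESets (hatd-OfESets d G k) (Inc-OfESets (hatd-OfESets d G (k ∸ 1))))
    (≐-trans (Inc-cong (slices-right d 1≤d esG))
             (Inc-RUnion (hatd d G) (hatd-below esG) (λ k û h → proj₂ (proj₂ (hatd-OfESets d G k û h))) (hatd-zero d G)))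

  Inc-CompL : Inc (CompL d G) ≐ LUnion (λ k → Inc (Comp (d ∸ 1) k (hat1 d G k)) ∪ π₁ (Comp (d ∸ 1) (k ∸ 1) (hat1 d G (k ∸ 1))))
  Inc-CompL = Inc-LUnion (λ k → Comp (d ∸ 1) k (hat1 d G k)) (λ k → Comp-above) (Comp-empty (hat1-zero d G))
  Inc-CompR : Inc (CompR d G) ≐ RUnion (λ k → Comp (d ∸ 1) 0 (hatd d G k) ∪ Inc (Comp (d ∸ 1) 0 (hatd d G (k ∸ 1))))
  Inc-CompR = Inc-RUnion (λ k → Comp (d ∸ 1) 0 (hatd d G k))
    (λ k → Comp-bounded (hatd-OfESets d G k) (hatd-below esG k)) (λ k → Comp-above) (Comp-empty (hatd-zero d G))
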